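{- Let $\alpha=(\alpha_1,\dots,\alpha_l)$ be a dotted composition with $\alpha\vdash(n,m)$, and let $D(\alpha)$, $E(\alpha)$, $F(\alpha)$ be as defined in the context. Then $$L_\alpha=\sum \Big(\prod_{j\in F(\alpha)}\theta_{i_j}\Big)\prod_{k\in\{1,\dots,n+m\}\setminus F(\alpha)}x_{i_k},$$ where the sum runs over all sequences of positive integers $i_1\le i_2\le\cdots\le i_{n+m}$ such that $i_k<i_{k+1}$ whenever $k\in D(\alpha)$ and $i_k=i_{k+1}$ whenever $k\in E(\alpha)$, and where the product of the $\theta$'s is taken in increasing order of $j$.
   Context: Let $x_1,x_2,\dots$ be commuting variables and $\theta_1,\theta_2,\dots$ anticommuting variables ($\theta_i\theta_j=-\theta_j\theta_i$, $\theta_i^2=0$), the $\theta$'s commuting with the $x$'s; we work in formal power series of finite degree in these variables over $\mathbb Q$. A dotted composition is a finite sequence $\alpha=(\alpha_1,\dots,\alpha_l)$ each of whose entries is either a positive integer (non-dotted) or a dotted nonnegative integer $\dot 0,\dot 1,\dot 2,\dots$. Set $\eta_i=1$ if $\alpha_i$ is dotted and $\eta_i=0$ otherwise. The total degree $|\alpha|$ is $\alpha_1+\cdots+\alpha_l$ (dots ignored), the fermionic degree is the number of dotted entries, and $\alpha\vdash(n,m)$ means total degree $n$ and fermionic degree $m$. The monomial quasisymmetric function in superspace is $M_\alpha=\sum_{i_1<\cdots<i_l}\theta_{i_1}^{\eta_1}\cdots\theta_{i_l}^{\eta_l}x_{i_1}^{\alpha_1}\cdots x_{i_l}^{\alpha_l}$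 (with dots ignored in exponents). The partial order $\preccurlyeq$ on dotted compositions is the reflexive–transitive closure of the relation: $\beta\preccurlyeq\alpha$ if $\alpha$ is obtained from $\beta$ by replacing two adjacent non-dotted parts by their sum. The fundamental quasisymmetric function in superspace is $L_\alpha=\sum_{\beta\preccurlyeq\alpha}M_\beta$. With partial sums $s_k=\sum_{t=1}^k(\alpha_t+\eta_t)$ ($s_0=0$), define $D(\alpha)=\{s_1,\dots,s_{l-1}\}$, $E(\alpha)=\{j: s_{i-1}<j<s_i \text{ for some } i \text{ with } \alpha_i \text{ dotted}\}$, and $F(\alpha)=\{s_i:\alpha_i\text{ dotted}\}$. (Note $s_l=n+m$.) -}

module Defs where

open import Data.Nat using (ℕ; zero; suc; _+_; _≤_; _≡ᵇ_; _<ᵇ_)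
open import Data.Nat.ListAction using (sum)
open import Data.Bool.ListAction using (any; all)
open import Data.Bool using (Bool; true; false; _∧_; _∨_; not; if_then_else_)
open import Data.Fin using (Fin; toℕ)
open import Data.List using (List; []; _∷_; _++_; map; concatMap; replicate; length; filter; foldr)
open import Data.List.Relation.Unary.All using (All)
open import Data.Vec using (Vec; lookup)
open import Data.Product using (_×_; _,_)
open import Data.Unit using (⊤)
open import Data.Rational using (ℚ; 0ℚ; 1ℚ; -_) renaming (_+_ to _+ℚ_)
open import Relation.Binary.Construct.Closure.ReflexiveTransitive using (Star)

-- A part: non-dotted (nd k, required positive) or dotted (dt k, k ≥ 0).
data Part : Set where
  nd : ℕ → Part
  dt : ℕ → Part

DComp : Set
DComp = List Part

val : Part → ℕ
val (nd k) = k
val (dt k) = k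

eta : Part → ℕ
eta (nd _) = 0
eta (dt _) = 1

isDot : Part → Bool
isDot (nd _) = false
isDot (dt _) = true

PosIfPlain : Part → Set
PosIfPlain (nd k) = 1 ≤ k
PosIfPlain (dt _) = ⊤

IsDComp : DComp → Set
IsDComp α = All PosIfPlain α

totalDeg : DComp → ℕ
totalDeg α = sum (map val α)

fermDeg : DComp → ℕ
fermDeg α = sum (map eta α)

data Merge : DComp → DComp → Set where
  merge : ∀ (p q : DComp) (a b : ℕ) →
          Merge (p ++ nd a ∷ nd b ∷ q) (p ++ nd (a + b) ∷ q)

_≼_ : DComp → DComp → Set
β ≼ α = Star Merge β α

-- Partial sums and the sets D, E, F (positions are 1-based)

-- list of triples (s_{i-1}, s_i, α_i dotted?)
psums : ℕ → DComp → List (ℕ × ℕ × Bool)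
psums acc [] = []
psums acc (p ∷ ps) =
  (acc , acc + (val p + eta p) , isDot p)
    ∷ psums (acc + (val p + eta p)) ps

dropLast : {A : Set} → List A → List A
dropLast [] = []
dropLast (x ∷ []) = []
dropLast (x ∷ y ∷ xs) = x ∷ dropLast (y ∷ xs)

-- k ∈ D(α) = {s_1, …, s_{l-1}}
inD : DComp → ℕ → Bool
inD α k = any (λ { (a , b , d) → b ≡ᵇ k }) (dropLast (psums 0 α))

-- k ∈ E(α): s_{i-1} < k < s_i for some dotted α_i
inE : DComp → ℕ → Bool
inE α k = any (λ { (a , b , d) → d ∧ (a <ᵇ k) ∧ (k <ᵇ b) }) (psums 0 α)

-- k ∈ F(α): k = s_i for some dotted α_i
inF : DComp → ℕ → Bool
inF α k = any (λ { (a , b , d) → d ∧ (b ≡ᵇ k) }) (psums 0 α)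

-- Superspace polynomials in N variables x_1..x_N, θ_1..θ_N
-- (variables indexed by Fin N; index j stands for j+1).

data Letter (N : ℕ) : Set where
  x : Fin N → Letter N
  θ : Fin N → Letter N

-- a word is a product of letters in the given order
Word : ℕ → Set
Word N = List (Letter N)

-- a superspace polynomial, presented as a formal sum of words
SPoly : ℕ → Set
SPoly N = List (Word N)

-- a basis monomial x^e θ_{j1} ⋯ θ_{jr} (j1 < ⋯ < jr), given by the
-- exponent vector e and the set {j1,…,jr} as a Bool vector
Monomial : ℕ → Set
Monomial N = Vec ℕ N × Vec Bool N

_=ᶠ_ : {N : ℕ} → Fin N → Fin N → Bool
i =ᶠ j = toℕ i ≡ᵇ toℕ j

_<ᶠ_ : {N : ℕ} → Fin N → Fin N → Bool
i <ᶠ j = toℕ i <ᵇ toℕ j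

_≤ᶠ_ : {N : ℕ} → Fin N → Fin N → Bool
i ≤ᶠ j = (i <ᶠ j) ∨ (i =ᶠ j)

countX : {N : ℕ} → Fin N → Word N → ℕ
countX j [] = 0
countX j (x i ∷ w) = if i =ᶠ j then suc (countX j w) else countX j w
countX j (θ i ∷ w) = countX j w

thetas : {N : ℕ} → Word N → List (Fin N)
thetas [] = []
thetas (x i ∷ w) = thetas w
thetas (θ i ∷ w) = i ∷ thetas w

distinct : {N : ℕ} → List (Fin N) → Bool
distinct [] = true
distinct (i ∷ is) = not (any (i =ᶠ_) is) ∧ distinct is

inversions : {N : ℕ} → List (Fin N) → ℕ
inversions [] = 0
inversions (i ∷ is) = length (filter (λ j → Data.Bool.T? (j <ᶠ i)) is) + inversions is

sgn : ℕ → ℚ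
sgn zero = 1ℚ
sgn (suc n) = - sgn n

allFinL : (N : ℕ) → List (Fin N)
allFinL N = Data.List.allFin N

-- coefficient of the basis monomial μ in the word w
-- (using x's central, θ_iθ_j = -θ_jθ_i, θ_i² = 0)
coeffW : {N : ℕ} → Word N → Monomial N → ℚ
coeffW {N} w (e , s) =
  if all (λ j → countX j w ≡ᵇ lookup e j) (allFinL N)
     ∧ distinct (thetas w)
     ∧ all (λ j → eqB (any (j =ᶠ_) (thetas w)) (lookup s j)) (allFinL N)
  then sgn (inversions (thetas w)) else 0ℚ
  where
  eqB : Bool → Bool → Bool
  eqB true b = b
  eqB false b = not b

sumℚ : List ℚ → ℚ
sumℚ = foldr _+ℚ_ 0ℚ

coeff : {N : ℕ} → SPoly N → Monomial N → ℚ
coeff P μ = sumℚ (map (λ w → coeffW w μ) P)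

allSeqs : (N len : ℕ) → List (List (Fin N))
allSeqs N zero = [] ∷ []
allSeqs N (suc len) = concatMap (λ i → map (i ∷_) (allSeqs N len)) (allFinL N)

strictlyInc : {N : ℕ} → List (Fin N) → Bool
strictlyInc (a ∷ b ∷ r) = (a <ᶠ b) ∧ strictlyInc (b ∷ r)
strictlyInc _ = true

-- M_β (truncated to N variables)

partWord : {N : ℕ} → Part → Fin N → Word N
partWord (nd k) i = replicate k (x i)
partWord (dt k) i = θ i ∷ replicate k (x i)

wordM : {N : ℕ} → DComp → List (Fin N) → Word N
wordM (p ∷ ps) (i ∷ is) = partWord p i ++ wordM ps is
wordM _ _ = []

Mpoly : (N : ℕ) → DComp → SPoly N
Mpoly N β = map (wordM β) (filter (λ v → Data.Bool.T? (strictlyInc v)) (allSeqs N (length β)))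

-- L_α = Σ_{β ∈ Bs} M_β, where Bs lists {β : β ≼ α} (without repetition)
Lpoly : (N : ℕ) → List DComp → SPoly N
Lpoly N Bs = concatMap (Mpoly N) Bs

stepOK : {N : ℕ} → DComp → ℕ → Fin N → Fin N → Bool
stepOK α k a b =
  (a ≤ᶠ b)
  ∧ (if inD α k then a <ᶠ b else true)
  ∧ (if inE α k then a =ᶠ b else true)

-- first argument: position (1-based) of the head of the list
seqOK : {N : ℕ} → DComp → ℕ → List (Fin N) → Bool
seqOK α k (a ∷ b ∷ r) = stepOK α k a b ∧ seqOK α (suc k) (b ∷ r)
seqOK α k _ = true

-- (∏_{j ∈ F} θ_{i_j}) ∏_{k ∉ F} x_{i_k}, written as the word with
-- letter θ_{i_k} or x_{i_k} at position k (θ's in increasing order of k)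
wordR : {N : ℕ} → DComp → ℕ → List (Fin N) → Word N
wordR α k [] = []
wordR α k (i ∷ is) = (if inF α k then θ i else x i) ∷ wordR α (suc k) is

Rpoly : (N : ℕ) → DComp → ℕ → SPoly N
Rpoly N α len =
  map (wordR α 1) (filter (λ v → Data.Bool.T? (seqOK α 1 v)) (allSeqs N len))

{-# OPTIONS --safe #-}
module Submission where

-- A term of L_α is indexed by a refinement β ≼ α and indices i₁ < ⋯ < i_l.  Repeating each
-- i_t (β_t + η_t) times expands it into a weakly increasing sequence of length n + m which
-- increases strictly at the end of each part of α, is constant on each dotted part, and,
-- inside a non-dotted part of α, increases strictly exactly where β splits that part.  So
-- expansion is a bijection onto the index sequences of the right-hand side (β and the i_t
-- are read back off the runs of equal entries), and the words of corresponding terms differ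
-- only by moving each θ_i past some x_i, which does not change the monomial.

open import Defs
open import Data.Nat using (ℕ; zero; suc; _+_; _∸_; _≤_; _<_; z≤n; s≤s; z<s; s<s; _≡ᵇ_; _<ᵇ_)
import Data.Nat.Properties as ℕ
open import Algebra.Properties.CommutativeSemigroup ℕ.+-commutativeSemigroup using (interchange)
open import Data.Bool using (Bool; true; false; _∧_; _∨_; if_then_else_; T; T?)
open import Data.Bool.Properties using (T-∧; T-∨; T-≡; ∨-identityʳ; ∧-zeroʳ; ∧-identityʳ)
open import Data.Bool.ListAction using (any; all; and)
open import Data.Fin using (Fin; toℕ)
open import Data.Vec using (lookup)
open import Data.Fin.Properties using (toℕ-injective)
open import Data.List using (List; []; _∷_; _++_; map; replicate; length; drop; zipWith; concatMap; filter)
open import Data.List.Properties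
  using ( map-cong; map-∘; map-id-local; map-concatMap; concatMap-cong; zipWith-zeroʳ
        ; length-++; length-replicate; drop-[]; ∷-injective)
open import Data.List.Relation.Unary.All as All using (All; []; _∷_)
import Data.List.Relation.Unary.All.Properties as All
open import Data.List.Relation.Unary.AllPairs as AllPairs using ([]; _∷_)
import Data.List.Relation.Unary.AllPairs.Properties as AllPairs
open import Data.List.Relation.Unary.Any using (here; there)
open import Data.List.Relation.Unary.Unique.Propositional using (Unique)
import Data.List.Relation.Unary.Unique.Propositional.Properties as Unique
open import Data.List.Relation.Binary.Disjoint.Propositional using (Disjoint)
open import Data.List.Membership.Propositional using (_∈_)
open import Data.List.Membership.Propositional.Properties
  using (∈-map⁺; ∈-map⁻; ∈-filter⁺; ∈-filter⁻; ∈-concat⁺′; ∈-concat⁻′; ∈-allFin)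
open import Data.List.Membership.Propositional.Properties.WithK using (unique∧set⇒bag)
open import Data.List.Relation.Binary.BagAndSetEquality using (∼bag⇒↭)
open import Data.List.Relation.Binary.Permutation.Propositional using (_↭_; ↭⇒↭ₛ)
import Data.List.Relation.Binary.Permutation.Propositional.Properties as ↭
open import Data.List.Relation.Binary.Permutation.Setoid.Properties using (foldr-commMonoid)
open import Data.Rational using (ℚ) renaming (_+_ to _+ℚ_)
import Data.Rational.Properties as ℚ
open import Data.Product
  using (_×_; _,_; proj₁; proj₂; Σ; ∃; ∃₂; map₁; uncurry) renaming (map to ×-map)
open import Data.Sum using (_⊎_; inj₁; inj₂)
open import Data.Unit using (⊤; tt)
open import Function using (_∘_)
open import Function.Bundles using (_⇔_; mk⇔; Equivalence)
open import Relation.Binary.PropositionalEquality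
  using (_≡_; _≢_; refl; sym; trans; cong; cong₂; subst; ≢-sym; setoid; module ≡-Reasoning)
open import Relation.Binary.Construct.Closure.ReflexiveTransitive using (ε; _◅_; _◅◅_; gmap)
open import Relation.Nullary using (¬_)

open Equivalence using (to; from)

¬T⇒≡false : ∀ {b} → ¬ T b → b ≡ false
¬T⇒≡false {false} _  = refl
¬T⇒≡false {true}  ¬t with () ← ¬t tt

≡ᵇ-false : ∀ {m n} → m ≢ n → (m ≡ᵇ n) ≡ false
≡ᵇ-false {m} {n} m≢n = ¬T⇒≡false (m≢n ∘ ℕ.≡ᵇ⇒≡ m n)

≡ᵇ-refl : ∀ n → (n ≡ᵇ n) ≡ true
≡ᵇ-refl n = to T-≡ (ℕ.≡⇒≡ᵇ n n refl)

<ᵇ-false : ∀ {m n} → n ≤ m → (m <ᵇ n) ≡ false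
<ᵇ-false {m} {n} n≤m = ¬T⇒≡false (ℕ.≤⇒≯ n≤m ∘ ℕ.<ᵇ⇒< m n)

<ᵇ-true : ∀ {m n} → m < n → (m <ᵇ n) ≡ true
<ᵇ-true m<n = to T-≡ (ℕ.<⇒<ᵇ m<n)

>⇒≢ : ∀ {m n} → n < m → m ≢ n
>⇒≢ n<m = ≢-sym (ℕ.<⇒≢ n<m)

all-cong : ∀ {A : Set} {f g : A → Bool} → (∀ a → f a ≡ g a) → ∀ xs → all f xs ≡ all g xs
all-cong f≗g xs = cong and (map-cong f≗g xs)

drop-block : ∀ {A : Set} t j {x y : A} {ys s ss} → drop j (replicate t x ++ y ∷ ys) ≡ s ∷ ss →
             (j < t × s ≡ x) ⊎ (j ≡ t × s ≡ y) ⊎ ∃ λ j′ → j ≡ suc t + j′ × drop j′ ys ≡ s ∷ ss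
drop-block zero    zero    refl = inj₂ (inj₁ (refl , refl))
drop-block zero    (suc j) eq   = inj₂ (inj₂ (j , refl , eq))
drop-block (suc t) zero    refl = inj₁ (z<s , refl)
drop-block (suc t) (suc j) eq with drop-block t j eq
... | inj₁ (j<t , s≡x)            = inj₁ (s<s j<t , s≡x)
... | inj₂ (inj₁ (refl , s≡y))    = inj₂ (inj₁ (refl , s≡y))
... | inj₂ (inj₂ (j′ , refl , e)) = inj₂ (inj₂ (j′ , refl , e))

drop-suc : ∀ {A : Set} j (xs : List A) {y ys} → drop j xs ≡ y ∷ ys → drop (suc j) xs ≡ ys
drop-suc zero    (_ ∷ _)  refl = refl
drop-suc (suc j) (_ ∷ zs) eq   = drop-suc j zs eq

drop≡∷∷⇒< : ∀ {A : Set} j (xs : List A) {y y′ ys} → drop j xs ≡ y ∷ y′ ∷ ys → suc j < length xs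
drop≡∷∷⇒< zero    (_ ∷ _ ∷ _) refl = s<s z<s
drop≡∷∷⇒< (suc j) (_ ∷ zs)    eq   = s<s (drop≡∷∷⇒< j zs eq)

Unique-concatMap-map : ∀ {A B C : Set} (g : A → B → C) →
                       (∀ {a a′ b b′} → g a b ≡ g a′ b′ → a ≡ a′ × b ≡ b′) →
                       ∀ {xs} → Unique xs → (ys : A → List B) → (∀ a → Unique (ys a)) →
                       Unique (concatMap (λ a → map (g a) (ys a)) xs)
Unique-concatMap-map g g-injective u ys uys =
  Unique.concat⁺ (All.map⁺ (All.universal (λ a → Unique.map⁺ (proj₂ ∘ g-injective) (uys a)) _))
                 (AllPairs.map⁺ (AllPairs.map disjoint u))
  where
  disjoint : ∀ {a a′} → a ≢ a′ → Disjoint (map (g a) (ys a)) (map (g a′) (ys a′))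
  disjoint a≢a′ (z∈ , z∈′) with ∈-map⁻ (g _) z∈ | ∈-map⁻ (g _) z∈′
  ... | _ , _ , refl | _ , _ , eq = a≢a′ (proj₁ (g-injective eq))

-- Refinements

-- β ⊑ α : β is obtained from α by splitting non-dotted parts.  The rules build both
-- compositions one unit at a time, following the positions of the expanded sequence:
-- grow-nd extends the current parts of β and α together, cut-nd ends the current part of β
-- strictly inside the current part of α.
infix 4 _⊑_

data _⊑_ : DComp → DComp → Set where
  []       : [] ⊑ []
  end-dot  : ∀ {β α} → β ⊑ α → dt 0 ∷ β ⊑ dt 0 ∷ α
  grow-dot : ∀ {k β α} → dt k ∷ β ⊑ dt k ∷ α → dt (suc k) ∷ β ⊑ dt (suc k) ∷ α
  end-nd   : ∀ {β α} → β ⊑ α → nd 1 ∷ β ⊑ nd 1 ∷ α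
  grow-nd  : ∀ {a t β α} → nd (suc a) ∷ β ⊑ nd (suc t) ∷ α →
             nd (suc (suc a)) ∷ β ⊑ nd (suc (suc t)) ∷ α
  cut-nd   : ∀ {t β α} → β ⊑ nd (suc t) ∷ α → nd 1 ∷ β ⊑ nd (suc (suc t)) ∷ α

incPart : Part → Part
incPart (nd a) = nd (suc a)
incPart (dt k) = dt (suc k)

incHead : DComp → DComp
incHead []      = []
incHead (p ∷ β) = incPart p ∷ β

⊑⇒IsDComp : ∀ {β α} → β ⊑ α → IsDComp β
⊑⇒IsDComp []           = []
⊑⇒IsDComp (end-dot r)  = tt ∷ ⊑⇒IsDComp r
⊑⇒IsDComp (grow-dot r) = tt ∷ All.tail (⊑⇒IsDComp r)
⊑⇒IsDComp (end-nd r)   = s≤s z≤n ∷ ⊑⇒IsDComp r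
⊑⇒IsDComp (grow-nd r)  = s≤s z≤n ∷ All.tail (⊑⇒IsDComp r)
⊑⇒IsDComp (cut-nd r)   = s≤s z≤n ∷ ⊑⇒IsDComp r

∷-≼ : ∀ p {β α} → β ≼ α → (p ∷ β) ≼ (p ∷ α)
∷-≼ p = gmap (p ∷_) λ { (merge q r a b) → merge (p ∷ q) r a b }

incHead-≼ : ∀ {β α} → β ≼ α → incHead β ≼ incHead α
incHead-≼ = gmap incHead λ where
  (merge []      q a b) → merge [] q (suc a) b
  (merge (c ∷ p) q a b) → merge (incPart c ∷ p) q a b

⊑⇒≼ : ∀ {β α} → β ⊑ α → β ≼ α
⊑⇒≼ []                     = ε
⊑⇒≼ (end-dot r)            = ∷-≼ (dt 0) (⊑⇒≼ r)
⊑⇒≼ (grow-dot r)           = incHead-≼ (⊑⇒≼ r)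
⊑⇒≼ (end-nd r)             = ∷-≼ (nd 1) (⊑⇒≼ r)
⊑⇒≼ (grow-nd r)            = incHead-≼ (⊑⇒≼ r)
⊑⇒≼ (cut-nd {t} {α = α} r) = ∷-≼ (nd 1) (⊑⇒≼ r) ◅◅ merge [] α 1 (suc t) ◅ ε

⊑-dt : ∀ k {β α} → β ⊑ α → dt k ∷ β ⊑ dt k ∷ α
⊑-dt zero    r = end-dot r
⊑-dt (suc k) r = grow-dot (⊑-dt k r)

⊑-nd : ∀ a {β α} → β ⊑ α → nd (suc a) ∷ β ⊑ nd (suc a) ∷ α
⊑-nd zero    r = end-nd r
⊑-nd (suc a) r = grow-nd (⊑-nd a r)

⊑-refl : ∀ {α} → IsDComp α → α ⊑ α
⊑-refl {[]}       []            = []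
⊑-refl {dt k ∷ _} (_ ∷ d)       = ⊑-dt k (⊑-refl d)
⊑-refl {nd _ ∷ _} (s≤s z≤n ∷ d) = ⊑-nd _ (⊑-refl d)

⊑-unmerge : ∀ p q a b {α} → p ++ nd (suc a + suc b) ∷ q ⊑ α →
            p ++ nd (suc a) ∷ nd (suc b) ∷ q ⊑ α
⊑-unmerge []      q zero    b (grow-nd r)      = cut-nd r
⊑-unmerge []      q (suc a) b (grow-nd r)      = grow-nd (⊑-unmerge [] q a b r)
⊑-unmerge (_ ∷ p) q a b (end-dot r)            = end-dot (⊑-unmerge p q a b r)
⊑-unmerge (_ ∷ p) q a b (grow-dot {k} r)       = grow-dot (⊑-unmerge (dt k ∷ p) q a b r)
⊑-unmerge (_ ∷ p) q a b (end-nd r)             = end-nd (⊑-unmerge p q a b r)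
⊑-unmerge (_ ∷ p) q a b (grow-nd {c} r)        = grow-nd (⊑-unmerge (nd (suc c) ∷ p) q a b r)
⊑-unmerge (_ ∷ p) q a b (cut-nd r)             = cut-nd (⊑-unmerge p q a b r)

merge-IsDComp : ∀ p q a b → IsDComp (p ++ nd a ∷ nd b ∷ q) →
                1 ≤ a × 1 ≤ b × IsDComp (p ++ nd (a + b) ∷ q)
merge-IsDComp p q a b d with All.++⁻ p d
... | dp , pa ∷ pb ∷ dq = pa , pb , All.++⁺ dp (ℕ.≤-trans pa (ℕ.m≤m+n a b) ∷ dq)

≼⇒⊑ : ∀ {β α} → IsDComp β → β ≼ α → β ⊑ α
≼⇒⊑ d ε                   = ⊑-refl d
≼⇒⊑ d (merge p q a b ◅ s) with merge-IsDComp p q a b d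
... | s≤s z≤n , s≤s z≤n , d′ = ⊑-unmerge p q _ _ (≼⇒⊑ d′ s)

-- Positions of the expanded sequence

-- Position k of a sequence of length n + m lies in the block of α_i when s_{i-1} < k ≤ s_i;
-- it is `end d` if k = s_i and `mid d` otherwise, where d records whether α_i is dotted.
-- So D(α) consists of the `end` positions but the last, E(α) of the `mid true` positions
-- and F(α) of the `end true` positions.
data Slot : Set where
  mid end : Bool → Slot

isEnd : Slot → Bool
isEnd (mid _) = false
isEnd (end _) = true

isMidDot : Slot → Bool
isMidDot (mid d) = d
isMidDot (end _) = false

isEndDot : Slot → Bool
isEndDot (mid _) = false
isEndDot (end d) = d

inner : Part → ℕ
inner (nd k) = k ∸ 1
inner (dt k) = k

width : Part → ℕ
width p = suc (inner p)

layout : DComp → List Slot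
layout []      = []
layout (p ∷ α) = replicate (inner p) (mid (isDot p)) ++ end (isDot p) ∷ layout α

span : DComp → ℕ
span []      = 0
span (p ∷ α) = width p + span α

length-layout : ∀ α → length (layout α) ≡ span α
length-layout []      = refl
length-layout (p ∷ α) = begin
  length (replicate (inner p) _ ++ _ ∷ layout α)
    ≡⟨ length-++ (replicate (inner p) _) ⟩
  length (replicate (inner p) (mid (isDot p))) + suc (length (layout α))
    ≡⟨ cong₂ _+_ (length-replicate (inner p)) (cong suc (length-layout α)) ⟩
  inner p + suc (span α)
    ≡⟨ ℕ.+-suc (inner p) (span α) ⟩
  span (p ∷ α) ∎
  where open ≡-Reasoning

width≡ : ∀ {p} → PosIfPlain p → val p + eta p ≡ width p
width≡ {nd _} (s≤s z≤n) = ℕ.+-identityʳ _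
width≡ {dt k} _         = ℕ.+-comm k 1

degree≡span : ∀ {α} → IsDComp α → totalDeg α + fermDeg α ≡ span α
degree≡span {[]}    []       = refl
degree≡span {p ∷ α} (pp ∷ d) = begin
  (val p + totalDeg α) + (eta p + fermDeg α) ≡⟨ interchange (val p) (totalDeg α) (eta p) (fermDeg α) ⟩
  (val p + eta p) + (totalDeg α + fermDeg α) ≡⟨ cong₂ _+_ (width≡ pp) (degree≡span d) ⟩
  span (p ∷ α)                               ∎
  where open ≡-Reasoning

-- The sets D, E and F

Block : Set
Block = ℕ × ℕ × Bool

blocks : ℕ → DComp → List Block
blocks acc []      = []
blocks acc (p ∷ α) = (acc , acc + width p , isDot p) ∷ blocks (acc + width p) α

psums≡blocks : ∀ acc {α} → IsDComp α → psums acc α ≡ blocks acc α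
psums≡blocks acc {[]}    []       = refl
psums≡blocks acc {p ∷ α} (pp ∷ d) rewrite width≡ pp = cong (_ ∷_) (psums≡blocks (acc + width p) d)

endsAt : ℕ → Block → Bool
endsAt k (a , b , d) = b ≡ᵇ k

dottedAround : ℕ → Block → Bool
dottedAround k (a , b , d) = d ∧ (a <ᵇ k) ∧ (k <ᵇ b)

dottedEndsAt : ℕ → Block → Bool
dottedEndsAt k (a , b , d) = d ∧ (b ≡ᵇ k)

-- The test f, run on the block (s_{i-1}, s_i, d), reads φ off the slot of position k when k
-- lies in that block, and fails on every other block.
record ReadsSlot (k : ℕ) (f : Block → Bool) (φ : Slot → Bool) : Set where
  field
    before : ∀ {a b d} → b < k → f (a , b , d) ≡ false
    inside : ∀ {a b d} → a < k → k < b → f (a , b , d) ≡ φ (mid d)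
    atEnd  : ∀ {a d} → f (a , k , d) ≡ φ (end d)
    after  : ∀ {a b d} → k ≤ a → a < b → f (a , b , d) ≡ false

open ReadsSlot

endsAt-reads : ∀ k → ReadsSlot k (endsAt k) isEnd
endsAt-reads k = record
  { before = λ b<k → ≡ᵇ-false (ℕ.<⇒≢ b<k)
  ; inside = λ _ k<b → ≡ᵇ-false (>⇒≢ k<b)
  ; atEnd  = ≡ᵇ-refl k
  ; after  = λ k≤a a<b → ≡ᵇ-false (>⇒≢ (ℕ.≤-<-trans k≤a a<b))
  }

dottedAround-reads : ∀ k → ReadsSlot k (dottedAround k) isMidDot
dottedAround-reads k .before {a} {b} {d} b<k rewrite <ᵇ-false (ℕ.<⇒≤ b<k) | ∧-zeroʳ (a <ᵇ k) = ∧-zeroʳ d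
dottedAround-reads k .inside {a} {b} {d} a<k k<b rewrite <ᵇ-true a<k | <ᵇ-true k<b = ∧-identityʳ d
dottedAround-reads k .atEnd  {a} {d} rewrite <ᵇ-false (ℕ.≤-refl {k}) | ∧-zeroʳ (a <ᵇ k) = ∧-zeroʳ d
dottedAround-reads k .after  {a} {b} {d} k≤a _ rewrite <ᵇ-false k≤a = ∧-zeroʳ d

dottedEndsAt-reads : ∀ k → ReadsSlot k (dottedEndsAt k) isEndDot
dottedEndsAt-reads k .before {d = d} b<k rewrite ≡ᵇ-false (ℕ.<⇒≢ b<k) = ∧-zeroʳ d
dottedEndsAt-reads k .inside {d = d} _ k<b rewrite ≡ᵇ-false (>⇒≢ k<b) = ∧-zeroʳ d
dottedEndsAt-reads k .atEnd  {d = d} rewrite ≡ᵇ-refl k = ∧-identityʳ d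
dottedEndsAt-reads k .after  {d = d} k≤a a<b rewrite ≡ᵇ-false (>⇒≢ (ℕ.≤-<-trans k≤a a<b)) = ∧-zeroʳ d

module _ {k f φ} (R : ReadsSlot k f φ) where

  any-blocks-after : ∀ {c} α → k ≤ c → any f (blocks c α) ≡ false
  any-blocks-after         []      _   = refl
  any-blocks-after {c = c} (p ∷ α) k≤c =
    cong₂ _∨_ (after R k≤c (ℕ.m<m+n c z<s)) (any-blocks-after α (ℕ.≤-trans k≤c (ℕ.m≤m+n c (width p))))

  any-blocks : ∀ α acc j {s ss} → k ≡ acc + suc j → drop j (layout α) ≡ s ∷ ss → any f (blocks acc α) ≡ φ s
  any-blocks []      acc j k≡ eq with () ← trans (sym (drop-[] j)) eq
  any-blocks (p ∷ α) acc j k≡ eq with drop-block (inner p) j eq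
  ... | inj₁ (j<t , refl) =
    trans (cong₂ _∨_ (inside R acc<k k<end) (any-blocks-after α (ℕ.<⇒≤ k<end))) (∨-identityʳ _)
    where
    acc<k : acc < k
    acc<k = subst (acc <_) (sym k≡) (ℕ.m<m+n acc z<s)
    k<end : k < acc + width p
    k<end = subst (_< acc + width p) (sym k≡) (ℕ.+-monoʳ-< acc (s<s j<t))
  ... | inj₂ (inj₁ (refl , refl)) =
    trans (cong₂ _∨_ (subst (λ b → f (acc , b , isDot p) ≡ φ (end (isDot p))) k≡ (atEnd R))
                     (any-blocks-after α (ℕ.≤-reflexive k≡)))
          (∨-identityʳ _)
  ... | inj₂ (inj₂ (j′ , refl , eq′)) =
    cong₂ _∨_ (before R (subst (acc + width p <_) (sym k≡)
                                (ℕ.+-monoʳ-< acc (s<s (s<s (ℕ.m≤m+n (inner p) j′))))))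
              (any-blocks α (acc + width p) j′ (trans k≡ (shift acc (inner p) j′)) eq′)
    where
    shift : ∀ acc t j → acc + suc (suc t + j) ≡ (acc + suc t) + suc j
    shift acc t j = trans (cong (λ z → acc + suc z) (sym (ℕ.+-suc t j))) (sym (ℕ.+-assoc acc (suc t) (suc j)))

any-endsAt-dropLast : ∀ acc α {k} → k < acc + span α →
                      any (endsAt k) (dropLast (blocks acc α)) ≡ any (endsAt k) (blocks acc α)
any-endsAt-dropLast acc []          _   = refl
any-endsAt-dropLast acc (p ∷ [])    {k} k< =
  sym (cong (_∨ false) (≡ᵇ-false (>⇒≢ (subst (λ z → k < acc + z) (ℕ.+-identityʳ (width p)) k<))))
any-endsAt-dropLast acc (p ∷ q ∷ α) {k} k< =
  cong (endsAt k (acc , acc + width p , isDot p) ∨_)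
       (any-endsAt-dropLast (acc + width p) (q ∷ α) (subst (k <_) (sym (ℕ.+-assoc acc (width p) _)) k<))

inD-slot : ∀ {α j s s′ ss} → IsDComp α → drop j (layout α) ≡ s ∷ s′ ∷ ss → inD α (suc j) ≡ isEnd s
inD-slot {α} {j} d eq = begin
  any (endsAt (suc j)) (dropLast (psums 0 α))  ≡⟨ cong (any _ ∘ dropLast) (psums≡blocks 0 d) ⟩
  any (endsAt (suc j)) (dropLast (blocks 0 α)) ≡⟨ any-endsAt-dropLast 0 α j<span ⟩
  any (endsAt (suc j)) (blocks 0 α)            ≡⟨ any-blocks (endsAt-reads (suc j)) α 0 j refl eq ⟩
  isEnd _                                      ∎
  where
  open ≡-Reasoning
  j<span : suc j < span α
  j<span = subst (suc j <_) (length-layout α) (drop≡∷∷⇒< j (layout α) eq)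

inE-slot : ∀ {α j s ss} → IsDComp α → drop j (layout α) ≡ s ∷ ss → inE α (suc j) ≡ isMidDot s
inE-slot {α} {j} d eq =
  trans (cong (any _) (psums≡blocks 0 d)) (any-blocks (dottedAround-reads (suc j)) α 0 j refl eq)

inF-slot : ∀ {α j s ss} → IsDComp α → drop j (layout α) ≡ s ∷ ss → inF α (suc j) ≡ isEndDot s
inF-slot {α} {j} d eq =
  trans (cong (any _) (psums≡blocks 0 d)) (any-blocks (dottedEndsAt-reads (suc j)) α 0 j refl eq)

module _ {N : ℕ} where

  =ᶠ-refl : (i : Fin N) → T (i =ᶠ i)
  =ᶠ-refl i = ℕ.≡⇒≡ᵇ (toℕ i) (toℕ i) refl

  ≤ᶠ-refl : (i : Fin N) → T (i ≤ᶠ i)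
  ≤ᶠ-refl i = from (T-∨ {i <ᶠ i}) (inj₂ (=ᶠ-refl i))

  <ᶠ⇒≤ᶠ : {i j : Fin N} → T (i <ᶠ j) → T (i ≤ᶠ j)
  <ᶠ⇒≤ᶠ {i} {j} i<j = from (T-∨ {i <ᶠ j}) (inj₁ i<j)

  <ᶠ⇒≠ᶠ : {i j : Fin N} → T (i <ᶠ j) → (i =ᶠ j) ≡ false
  <ᶠ⇒≠ᶠ {i} {j} i<j = ≡ᵇ-false (ℕ.<⇒≢ (ℕ.<ᵇ⇒< (toℕ i) (toℕ j) i<j))

  stepTest : Bool → Bool → Fin N → Fin N → Bool
  stepTest D E a b = (a ≤ᶠ b) ∧ (if D then a <ᶠ b else true) ∧ (if E then a =ᶠ b else true)

  slotStep : Slot → Fin N → Fin N → Bool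
  slotStep s = stepTest (isEnd s) (isMidDot s)

  slotStep-mid-refl : ∀ d i → T (slotStep (mid d) i i)
  slotStep-mid-refl false i = from (T-∧ {i ≤ᶠ i}) (≤ᶠ-refl i , tt)
  slotStep-mid-refl true  i = from (T-∧ {i ≤ᶠ i}) (≤ᶠ-refl i , =ᶠ-refl i)

  slotStep-mid-< : ∀ i j → T (i <ᶠ j) → T (slotStep (mid false) i j)
  slotStep-mid-< i j i<j = from (T-∧ {i ≤ᶠ j}) (<ᶠ⇒≤ᶠ {i} {j} i<j , tt)

  slotStep-end-< : ∀ d i j → T (i <ᶠ j) → T (slotStep (end d) i j)
  slotStep-end-< _ i j i<j = from (T-∧ {i ≤ᶠ j}) (<ᶠ⇒≤ᶠ {i} {j} i<j , from (T-∧ {i <ᶠ j}) (i<j , tt))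

  slotStep-end⇒< : ∀ d i j → T (slotStep (end d) i j) → T (i <ᶠ j)
  slotStep-end⇒< _ i j step = proj₁ (to (T-∧ {i <ᶠ j}) (proj₂ (to (T-∧ {i ≤ᶠ j}) step)))

  slotStep-midDot⇒≡ : ∀ {i j} → T (slotStep (mid true) i j) → i ≡ j
  slotStep-midDot⇒≡ {i} {j} step =
    toℕ-injective (ℕ.≡ᵇ⇒≡ (toℕ i) (toℕ j) (proj₂ (to (T-∧ {i ≤ᶠ j}) step)))

  slotStep-mid⇒ : ∀ {i j} → T (slotStep (mid false) i j) → i ≡ j ⊎ T (i <ᶠ j)
  slotStep-mid⇒ {i} {j} step with to (T-∨ {i <ᶠ j}) (proj₁ (to (T-∧ {i ≤ᶠ j}) step))
  ... | inj₁ i<j = inj₂ i<j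
  ... | inj₂ i=j = inj₁ (toℕ-injective (ℕ.≡ᵇ⇒≡ (toℕ i) (toℕ j) i=j))

  chain : List Slot → List (Fin N) → Bool
  chain ss       []          = true
  chain ss       (a ∷ [])    = true
  chain []       (a ∷ b ∷ w) = true
  chain (s ∷ ss) (a ∷ b ∷ w) = slotStep s a b ∧ chain ss (b ∷ w)

  letter : Slot → Fin N → Letter N
  letter s i = if isEndDot s then θ i else x i

  seqOK≡chain : ∀ {α} → IsDComp α → ∀ j {ss} (v : List (Fin N)) → drop j (layout α) ≡ ss →
                length v ≤ length ss → seqOK α (suc j) v ≡ chain ss v
  seqOK≡chain d j []          _ _ = refl
  seqOK≡chain d j (_ ∷ [])    _ _ = refl
  seqOK≡chain d j {s ∷ s′ ∷ ss} (a ∷ b ∷ v) eq (s≤s le) =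
    cong₂ _∧_ (cong₂ (λ D E → stepTest D E a b) (inD-slot d eq) (inE-slot d eq))
              (seqOK≡chain d (suc j) (b ∷ v) (drop-suc j _ eq) le)

  wordR≡zipWith : ∀ {α} → IsDComp α → ∀ j {ss} (v : List (Fin N)) → drop j (layout α) ≡ ss →
                  length v ≤ length ss → wordR α (suc j) v ≡ zipWith letter ss v
  wordR≡zipWith d j []      _ _ = sym (zipWith-zeroʳ letter _)
  wordR≡zipWith d j {s ∷ ss} (i ∷ v) eq (s≤s le) =
    cong₂ _∷_ (cong (λ F → if F then θ i else x i) (inF-slot d eq))
              (wordR≡zipWith d (suc j) v (drop-suc j _ eq) le)

  -- Expansion

  expand : DComp → List (Fin N) → List (Fin N)
  expand (p ∷ β) (i ∷ v) = replicate (width p) i ++ expand β v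
  expand _       _       = []

  OnHead : (Fin N → Set) → List (Fin N) → Set
  OnHead P []      = ⊤
  OnHead P (j ∷ _) = P j

  _≺_ : Fin N → List (Fin N) → Set
  i ≺ v = OnHead (λ j → T (i <ᶠ j)) v

  OnHead-map : ∀ {P Q : Fin N → Set} → (∀ j → P j → Q j) → ∀ w → OnHead P w → OnHead Q w
  OnHead-map f []      _ = tt
  OnHead-map f (j ∷ _) h = f j h

  OnHead-expand⁺ : ∀ {P} β v → OnHead P v → OnHead P (expand β v)
  OnHead-expand⁺ []      _       _ = tt
  OnHead-expand⁺ (_ ∷ _) []      _ = tt
  OnHead-expand⁺ (_ ∷ _) (_ ∷ _) h = h

  OnHead-expand⁻ : ∀ {P} β v → length v ≡ length β → OnHead P (expand β v) → OnHead P v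
  OnHead-expand⁻ []      []      _ _ = tt
  OnHead-expand⁻ (_ ∷ _) (_ ∷ _) _ h = h

  strictlyInc-head : ∀ (i : Fin N) v → T (strictlyInc (i ∷ v)) → i ≺ v
  strictlyInc-head _ []      _   = tt
  strictlyInc-head i (j ∷ _) inc = proj₁ (to (T-∧ {i <ᶠ j}) inc)

  strictlyInc-tail : ∀ (i : Fin N) v → T (strictlyInc (i ∷ v)) → T (strictlyInc v)
  strictlyInc-tail _ []      _   = tt
  strictlyInc-tail i (j ∷ _) inc = proj₂ (to (T-∧ {i <ᶠ j}) inc)

  strictlyInc-∷ : ∀ (i : Fin N) v → i ≺ v → T (strictlyInc v) → T (strictlyInc (i ∷ v))
  strictlyInc-∷ _ []      _   _   = tt
  strictlyInc-∷ i (j ∷ _) i<j inc = from (T-∧ {i <ᶠ j}) (i<j , inc)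

  chain-∷⁻ : ∀ {s ss i} w → T (chain (s ∷ ss) (i ∷ w)) → OnHead (T ∘ slotStep s i) w × T (chain ss w)
  chain-∷⁻             []      _ = tt , tt
  chain-∷⁻ {s} {i = i} (j ∷ _) c = to (T-∧ {slotStep s i j}) c

  chain-∷⁺ : ∀ s {ss} i w → OnHead (T ∘ slotStep s i) w → T (chain ss w) → T (chain (s ∷ ss) (i ∷ w))
  chain-∷⁺ _ _ []      _    _ = tt
  chain-∷⁺ s i (j ∷ _) step c = from (T-∧ {slotStep s i j}) (step , c)

  chain-∷-expand : ∀ s {ss} i β v → (∀ j → T (i <ᶠ j) → T (slotStep s i j)) →
                   T (strictlyInc (i ∷ v)) → T (chain ss (expand β v)) → T (chain (s ∷ ss) (i ∷ expand β v))
  chain-∷-expand s i β v step inc c =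
    chain-∷⁺ s i (expand β v) (OnHead-expand⁺ β v (OnHead-map step v (strictlyInc-head i v inc))) c

  expand-chain : ∀ {β α} → β ⊑ α → ∀ v → T (strictlyInc v) → T (chain (layout α) (expand β v))
  expand-chain {[]}    _ _  _ = tt
  expand-chain {_ ∷ _} _ [] _ = tt
  expand-chain (end-dot {β} r) (i ∷ v) inc =
    chain-∷-expand (end true) i β v (slotStep-end-< true i) inc (expand-chain r v (strictlyInc-tail i v inc))
  expand-chain (grow-dot {k} {β} r) (i ∷ v) inc =
    chain-∷⁺ (mid true) i (expand (dt k ∷ β) (i ∷ v)) (slotStep-mid-refl true i)
             (expand-chain r (i ∷ v) inc)
  expand-chain (end-nd {β} r) (i ∷ v) inc =
    chain-∷-expand (end false) i β v (slotStep-end-< false i) inc (expand-chain r v (strictlyInc-tail i v inc))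
  expand-chain (grow-nd {a} {β = β} r) (i ∷ v) inc =
    chain-∷⁺ (mid false) i (expand (nd (suc a) ∷ β) (i ∷ v)) (slotStep-mid-refl false i)
             (expand-chain r (i ∷ v) inc)
  expand-chain (cut-nd {β = β} r) (i ∷ v) inc =
    chain-∷-expand (mid false) i β v (slotStep-mid-< i) inc (expand-chain r v (strictlyInc-tail i v inc))

  length-expand : ∀ {β α} → β ⊑ α → ∀ {v} → length v ≡ length β → length (expand β v) ≡ span α
  length-expand []             {[]}    _   = refl
  length-expand (end-dot r)    {_ ∷ _} len = cong suc (length-expand r (ℕ.suc-injective len))
  length-expand (grow-dot r)   {_ ∷ _} len = cong suc (length-expand r len)
  length-expand (end-nd r)     {_ ∷ _} len = cong suc (length-expand r (ℕ.suc-injective len))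
  length-expand (grow-nd r)    {_ ∷ _} len = cong suc (length-expand r len)
  length-expand (cut-nd r)     {_ ∷ _} len = cong suc (length-expand r (ℕ.suc-injective len))

  -- Reads (β, v) back off an expanded sequence: inside a non-dotted part of α, a new part
  -- of β starts exactly where the sequence increases strictly.
  compress : DComp → List (Fin N) → DComp × List (Fin N)
  compress (dt zero ∷ α)          (i ∷ w)     = ×-map (dt 0 ∷_) (i ∷_) (compress α w)
  compress (dt (suc k) ∷ α)       (i ∷ w)     = map₁ incHead (compress (dt k ∷ α) w)
  compress (nd (suc zero) ∷ α)    (i ∷ w)     = ×-map (nd 1 ∷_) (i ∷_) (compress α w)
  compress (nd (suc (suc t)) ∷ α) (i ∷ j ∷ w) =
    if i =ᶠ j then map₁ incHead (compress (nd (suc t) ∷ α) (j ∷ w))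
              else ×-map (nd 1 ∷_) (i ∷_) (compress (nd (suc t) ∷ α) (j ∷ w))
  compress _                      _           = [] , []

  compress-expand : ∀ {β α} → β ⊑ α → ∀ v → T (strictlyInc v) → length v ≡ length β →
                    compress α (expand β v) ≡ (β , v)
  compress-expand []           []      _   _   = refl
  compress-expand (end-dot r)  (i ∷ v) inc len =
    cong (×-map (dt 0 ∷_) (i ∷_)) (compress-expand r v (strictlyInc-tail i v inc) (ℕ.suc-injective len))
  compress-expand (grow-dot r) (i ∷ v) inc len = cong (map₁ incHead) (compress-expand r (i ∷ v) inc len)
  compress-expand (end-nd r)   (i ∷ v) inc len =
    cong (×-map (nd 1 ∷_) (i ∷_)) (compress-expand r v (strictlyInc-tail i v inc) (ℕ.suc-injective len))
  compress-expand (grow-nd r)  (i ∷ v) inc len rewrite ≡ᵇ-refl (toℕ i) =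
    cong (map₁ incHead) (compress-expand r (i ∷ v) inc len)
  compress-expand (cut-nd {β = _ ∷ _} r) (i ∷ j ∷ v) inc len
    rewrite <ᶠ⇒≠ᶠ {i} {j} (strictlyInc-head i (j ∷ v) inc) =
    cong (×-map (nd 1 ∷_) (i ∷_))
         (compress-expand r (j ∷ v) (strictlyInc-tail i (j ∷ v) inc) (ℕ.suc-injective len))
  compress-expand (cut-nd {β = []} ()) _ _ _
  compress-expand (cut-nd {β = _ ∷ _} _) (_ ∷ []) _ ()

  data Preimage (α : DComp) (w : List (Fin N)) : Set where
    preimage : ∀ {β v} → β ⊑ α → T (strictlyInc v) → length v ≡ length β → expand β v ≡ w → Preimage α w

  data Preimage∷ (q : Part) (α : DComp) (i : Fin N) (w : List (Fin N)) : Set where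
    preimage∷ : ∀ {β v} → q ∷ β ⊑ α → T (strictlyInc (i ∷ v)) → length v ≡ length β →
                expand (q ∷ β) (i ∷ v) ≡ i ∷ w → Preimage∷ q α i w

  Preimage∷⇒Preimage : ∀ {q α i w} → Preimage∷ q α i w → Preimage α (i ∷ w)
  Preimage∷⇒Preimage (preimage∷ r inc len eq) = preimage r inc (cong suc len) eq

  ChainPreimages : DComp → Set
  ChainPreimages α = ∀ {w} → T (chain (layout α) w) → length w ≡ span α → Preimage α w

  tail-preimage : ∀ {α} s i w → (∀ j → T (slotStep s i j) → T (i <ᶠ j)) → ChainPreimages α →
                  T (chain (s ∷ layout α) (i ∷ w)) → length w ≡ span α →
                  ∃₂ λ β v → β ⊑ α × T (strictlyInc (i ∷ v)) × length v ≡ length β × expand β v ≡ w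
  tail-preimage s i w step⇒< IH c len with chain-∷⁻ w c
  ... | step , c′ with IH {w} c′ len
  ... | preimage {β} {v} r inc len′ refl =
    β , v , r , strictlyInc-∷ i v (OnHead-expand⁻ β v len′ (OnHead-map step⇒< (expand β v) step)) inc ,
    len′ , refl

  dot-preimage : ∀ {α} → ChainPreimages α → ∀ k {i w} → T (chain (layout (dt k ∷ α)) (i ∷ w)) →
                 length w ≡ k + span α → Preimage∷ (dt k) (dt k ∷ α) i w
  dot-preimage IH zero {i} {w} c len with tail-preimage (end true) i w (slotStep-end⇒< true i) IH c len
  ... | _ , _ , r , inc , len′ , refl = preimage∷ (end-dot r) inc len′ refl
  dot-preimage IH (suc k) {i} {j ∷ w} c len with to (T-∧ {slotStep (mid true) i j}) c
  ... | step , c′ with slotStep-midDot⇒≡ {i} {j} step | dot-preimage IH k {j} {w} c′ (ℕ.suc-injective len)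
  ... | refl | preimage∷ r inc len′ eq = preimage∷ (grow-dot r) inc len′ (cong (i ∷_) eq)

  run-preimage : ∀ {α} → ChainPreimages α → ∀ t {i w} → T (chain (layout (nd (suc t) ∷ α)) (i ∷ w)) →
                 length w ≡ t + span α → Σ ℕ λ a → Preimage∷ (nd (suc a)) (nd (suc t) ∷ α) i w
  run-preimage IH zero {i} {w} c len with tail-preimage (end false) i w (slotStep-end⇒< false i) IH c len
  ... | _ , _ , r , inc , len′ , refl = 0 , preimage∷ (end-nd r) inc len′ refl
  run-preimage IH (suc t) {i} {j ∷ w} c len with to (T-∧ {slotStep (mid false) i j}) c
  ... | step , c′ with slotStep-mid⇒ {i} {j} step | run-preimage IH t {j} {w} c′ (ℕ.suc-injective len)
  ... | inj₁ refl | a , preimage∷ r inc len′ eq = suc a , preimage∷ (grow-nd r) inc len′ (cong (i ∷_) eq)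
  ... | inj₂ i<j  | a , preimage∷ {v = v} r inc len′ eq =
    0 , preimage∷ (cut-nd r) (strictlyInc-∷ i (j ∷ v) i<j inc) (cong suc len′) (cong (i ∷_) eq)

  chain⇒preimage : ∀ {α} → IsDComp α → ChainPreimages α
  chain⇒preimage {[]}             []      {[]}    _ _   = preimage {v = []} [] tt refl refl
  chain⇒preimage {dt k ∷ α}       (_ ∷ d) {i ∷ w} c len =
    Preimage∷⇒Preimage (dot-preimage (chain⇒preimage d) k {i} {w} c (ℕ.suc-injective len))
  chain⇒preimage {nd (suc t) ∷ α} (_ ∷ d) {i ∷ w} c len =
    Preimage∷⇒Preimage (proj₂ (run-preimage (chain⇒preimage d) t {i} {w} c (ℕ.suc-injective len)))
  chain⇒preimage {nd zero ∷ _}    (() ∷ _)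

  -- Monomials

  infix 4 _≃_
  record _≃_ (w w′ : Word N) : Set where
    constructor mk≃
    field
      thetas≡ : thetas w ≡ thetas w′
      countX≡ : ∀ j → countX j w ≡ countX j w′

  ≃-refl : ∀ {w} → w ≃ w
  ≃-refl = mk≃ refl (λ _ → refl)

  ≃-trans : ∀ {u v w} → u ≃ v → v ≃ w → u ≃ w
  ≃-trans (mk≃ t₁ c₁) (mk≃ t₂ c₂) = mk≃ (trans t₁ t₂) (λ j → trans (c₁ j) (c₂ j))

  ≃-∷ : ∀ l {w w′} → w ≃ w′ → l ∷ w ≃ l ∷ w′
  ≃-∷ (x i) (mk≃ t c) = mk≃ t (λ j → cong (λ n → if i =ᶠ j then suc n else n) (c j))
  ≃-∷ (θ i) (mk≃ t c) = mk≃ (cong (i ∷_) t) c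

  θx≃xθ : ∀ i j w → θ i ∷ x j ∷ w ≃ x j ∷ θ i ∷ w
  θx≃xθ i j w = mk≃ refl (λ _ → refl)

  coeffW-cong : ∀ {w w′} → w ≃ w′ → ∀ μ → coeffW w μ ≡ coeffW w′ μ
  coeffW-cong (mk≃ th cx) (e , s) rewrite th | all-cong (λ j → cong (_≡ᵇ lookup e j) (cx j)) (allFinL N) = refl

  wordM≃ : ∀ {β α} → β ⊑ α → ∀ v → length v ≡ length β → wordM β v ≃ zipWith letter (layout α) (expand β v)
  wordM≃ []           []      _   = ≃-refl
  wordM≃ (end-dot r)  (i ∷ v) len = ≃-∷ (θ i) (wordM≃ r v (ℕ.suc-injective len))
  wordM≃ (grow-dot r) (i ∷ v) len = ≃-trans (θx≃xθ i i _) (≃-∷ (x i) (wordM≃ r (i ∷ v) len))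
  wordM≃ (end-nd r)   (i ∷ v) len = ≃-∷ (x i) (wordM≃ r v (ℕ.suc-injective len))
  wordM≃ (grow-nd r)  (i ∷ v) len = ≃-∷ (x i) (wordM≃ r (i ∷ v) len)
  wordM≃ (cut-nd r)   (i ∷ v) len = ≃-∷ (x i) (wordM≃ r v (ℕ.suc-injective len))

  ∈-allSeqs⁺ : (v : List (Fin N)) → v ∈ allSeqs N (length v)
  ∈-allSeqs⁺ []      = here refl
  ∈-allSeqs⁺ (i ∷ v) = ∈-concat⁺′ (∈-map⁺ (i ∷_) (∈-allSeqs⁺ v)) (∈-map⁺ _ (∈-allFin i))

  ∈-allSeqs⁻ : ∀ len {v : List (Fin N)} → v ∈ allSeqs N len → length v ≡ len
  ∈-allSeqs⁻ zero    (here refl) = refl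
  ∈-allSeqs⁻ (suc len) v∈ with ∈-concat⁻′ (map (λ i → map (i ∷_) (allSeqs N len)) (allFinL N)) v∈
  ... | vs , v∈vs , vs∈ with ∈-map⁻ _ vs∈
  ... | i , _ , refl with ∈-map⁻ (i ∷_) v∈vs
  ... | v′ , v′∈ , refl = cong suc (∈-allSeqs⁻ len v′∈)

  allSeqs-unique : ∀ len → Unique (allSeqs N len)
  allSeqs-unique zero      = [] ∷ []
  allSeqs-unique (suc len) =
    Unique-concatMap-map _∷_ ∷-injective (Unique.allFin⁺ N) (λ _ → allSeqs N len) (λ _ → allSeqs-unique len)

  incSeqs : ℕ → List (List (Fin N))
  incSeqs len = filter (λ v → T? (strictlyInc v)) (allSeqs N len)

  pairs : List DComp → List (DComp × List (Fin N))
  pairs Bs = concatMap (λ β → map (β ,_) (incSeqs (length β))) Bs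

  pairs-unique : ∀ {Bs} → Unique Bs → Unique (pairs Bs)
  pairs-unique u = Unique-concatMap-map _,_ (λ { refl → refl , refl }) u (incSeqs ∘ length)
                                        (λ β → Unique.filter⁺ _ (allSeqs-unique (length β)))

  ∈-pairs⁺ : ∀ {Bs β v} → β ∈ Bs → T (strictlyInc v) → length v ≡ length β → (β , v) ∈ pairs Bs
  ∈-pairs⁺ {β = β} {v} β∈ inc len =
    ∈-concat⁺′ (∈-map⁺ _ (∈-filter⁺ (λ v → T? (strictlyInc v)) v∈ inc)) (∈-map⁺ _ β∈)
    where
    v∈ : v ∈ allSeqs N (length β)
    v∈ = subst (λ l → v ∈ allSeqs N l) len (∈-allSeqs⁺ v)

  ∈-pairs⁻ : ∀ Bs {β v} → (β , v) ∈ pairs Bs → β ∈ Bs × T (strictlyInc v) × length v ≡ length β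
  ∈-pairs⁻ Bs p∈ with ∈-concat⁻′ (map (λ β → map (β ,_) (incSeqs (length β))) Bs) p∈
  ... | ps , p∈ps , ps∈ with ∈-map⁻ _ ps∈
  ... | β , β∈ , refl with ∈-map⁻ _ p∈ps
  ... | v , v∈ , refl with ∈-filter⁻ (λ v → T? (strictlyInc v)) v∈
  ... | v∈all , inc = β∈ , inc , ∈-allSeqs⁻ (length β) v∈all

  Lpoly≡pairs : ∀ Bs → Lpoly N Bs ≡ map (uncurry wordM) (pairs Bs)
  Lpoly≡pairs Bs = sym (begin
    map (uncurry wordM) (concatMap (λ β → map (β ,_) (incSeqs (length β))) Bs)
      ≡⟨ map-concatMap (uncurry wordM) _ Bs ⟩
    concatMap (λ β → map (uncurry wordM) (map (β ,_) (incSeqs (length β)))) Bs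
      ≡⟨ concatMap-cong (λ β → sym (map-∘ (incSeqs (length β)))) Bs ⟩
    concatMap (Mpoly N) Bs ∎)
    where open ≡-Reasoning

  coeff-↭ : ∀ {P P′ : SPoly N} → P ↭ P′ → ∀ μ → coeff P μ ≡ coeff P′ μ
  coeff-↭ P↭P′ μ = foldr-commMonoid (setoid ℚ) ℚ.+-0-isCommutativeMonoid (↭⇒↭ₛ (↭.map⁺ _ P↭P′))

  coeff-map-cong : ∀ {A : Set} {f g : A → Word N} xs → (∀ {a} → a ∈ xs → f a ≃ g a) →
                   ∀ μ → coeff (map f xs) μ ≡ coeff (map g xs) μ
  coeff-map-cong []       _ μ = refl
  coeff-map-cong (a ∷ xs) h μ = cong₂ _+ℚ_ (coeffW-cong (h (here refl)) μ) (coeff-map-cong xs (h ∘ there) μ)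

  rhsSeqs : DComp → ℕ → List (List (Fin N))
  rhsSeqs α L = filter (λ w → T? (seqOK α 1 w)) (allSeqs N L)

  module _ {α} (d : IsDComp α) where

    fits-layout : ∀ {w : List (Fin N)} → length w ≡ span α → length w ≤ length (layout α)
    fits-layout len = ℕ.≤-reflexive (trans len (sym (length-layout α)))

    seqOK≡chain₀ : ∀ w → length w ≡ span α → seqOK α 1 w ≡ chain (layout α) w
    seqOK≡chain₀ w len = seqOK≡chain d 0 w refl (fits-layout {w} len)

    wordR≡zipWith₀ : ∀ w → length w ≡ span α → wordR α 1 w ≡ zipWith letter (layout α) w
    wordR≡zipWith₀ w len = wordR≡zipWith d 0 w refl (fits-layout {w} len)

    module _ {Bs} (hB : ∀ β → β ∈ Bs ⇔ (IsDComp β × β ≼ α)) where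

      pair-refines : ∀ {β v} → (β , v) ∈ pairs Bs → β ⊑ α × T (strictlyInc v) × length v ≡ length β
      pair-refines {β} p∈ with ∈-pairs⁻ Bs p∈
      ... | β∈ , inc , len with to (hB β) β∈
      ... | dβ , β≼α = ≼⇒⊑ dβ β≼α , inc , len

      wordM≃wordR : ∀ {p} → p ∈ pairs Bs → uncurry wordM p ≃ wordR α 1 (uncurry expand p)
      wordM≃wordR {β , v} p∈ with pair-refines p∈
      ... | r , _ , len =
        subst (wordM β v ≃_) (sym (wordR≡zipWith₀ (expand β v) (length-expand r len))) (wordM≃ r v len)

      expand-sound : ∀ {w} → w ∈ map (uncurry expand) (pairs Bs) → w ∈ rhsSeqs α (span α)
      expand-sound w∈ with ∈-map⁻ (uncurry expand) w∈
      ... | (β , v) , p∈ , refl with pair-refines p∈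
      ... | r , inc , len =
        ∈-filter⁺ (λ w → T? (seqOK α 1 w))
                  (subst (λ l → expand β v ∈ allSeqs N l) lenE (∈-allSeqs⁺ (expand β v)))
                  (subst T (sym (seqOK≡chain₀ (expand β v) lenE)) (expand-chain r v inc))
        where lenE = length-expand r len

      expand-complete : ∀ {w} → w ∈ rhsSeqs α (span α) → w ∈ map (uncurry expand) (pairs Bs)
      expand-complete {w} w∈ with ∈-filter⁻ (λ w → T? (seqOK α 1 w)) w∈
      ... | w∈all , ok with ∈-allSeqs⁻ (span α) w∈all
      ... | len with chain⇒preimage d {w} (subst T (seqOK≡chain₀ w len) ok) len
      ... | preimage {β} {v} r inc len′ refl =
        ∈-map⁺ (uncurry expand) (∈-pairs⁺ (from (hB β) (⊑⇒IsDComp r , ⊑⇒≼ r)) inc len′)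

      compress∘expand : map (compress α) (map (uncurry expand) (pairs Bs)) ≡ pairs Bs
      compress∘expand = trans (sym (map-∘ (pairs Bs))) (map-id-local (All.tabulate λ {(β , v)} p∈ →
        let r , inc , len = pair-refines p∈ in compress-expand r v inc len))

      expand-↭ : Unique Bs → map (uncurry expand) (pairs Bs) ↭ rhsSeqs α (span α)
      expand-↭ uB = ∼bag⇒↭ (unique∧set⇒bag expansions-unique (Unique.filter⁺ _ (allSeqs-unique (span α)))
                                             (mk⇔ expand-sound expand-complete))
        where
        expansions-unique : Unique (map (uncurry expand) (pairs Bs))
        expansions-unique = Unique.map⁻ (subst Unique (sym compress∘expand) (pairs-unique uB))

mainTheorem1 : (α : DComp) (n m : ℕ) → IsDComp α →
    totalDeg α ≡ n → fermDeg α ≡ m →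
    (Bs : List DComp) → Unique Bs →
    (∀ β → (β ∈ Bs) ⇔ (IsDComp β × β ≼ α)) →
    (N : ℕ) (μ : Monomial N) →
    coeff (Lpoly N Bs) μ ≡ coeff (Rpoly N α (n + m)) μ
mainTheorem1 α _ _ d refl refl Bs uB hB N μ = begin
  coeff (Lpoly N Bs) μ
    ≡⟨ cong (λ W → coeff W μ) (Lpoly≡pairs Bs) ⟩
  coeff (map (uncurry wordM) P) μ
    ≡⟨ coeff-map-cong P (wordM≃wordR d hB) μ ⟩
  coeff (map (wordR α 1 ∘ uncurry expand) P) μ
    ≡⟨ cong (λ W → coeff W μ) (map-∘ P) ⟩
  coeff (map (wordR α 1) (map (uncurry expand) P)) μ
    ≡⟨ coeff-↭ (↭.map⁺ (wordR α 1) (expand-↭ d hB uB)) μ ⟩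
  coeff (Rpoly N α (span α)) μ
    ≡⟨ cong (λ L → coeff (Rpoly N α L) μ) (sym (degree≡span d)) ⟩
  coeff (Rpoly N α (totalDeg α + fermDeg α)) μ ∎
  where
  open ≡-Reasoning
  P : List (DComp × List (Fin N))
  P = pairs Bs
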